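{- Let $\mathcal{K}$ be a variety of algebras with $\mathbf{L}$-order of type $F$, and let $X$ be a set of variables with $T(X)\neq\emptyset$. Then the $\mathcal{K}$-free algebra with $\mathbf{L}$-order $\mathbf{F}_X(\mathcal{K})=\mathbf{T}(X)/\theta_{\mathcal{K}}$ belongs to $\mathcal{K}$.
   Context: $\mathbf{L}$ is a complete residuated lattice $\langle L,\wedge,\vee,\otimes,\rightarrow,0,1\rangle$; $F$ a fixed type. An algebra with $\mathbf{L}$-order of type $F$ is $\mathbf{M}=\langle M,\preccurlyeq^{\mathbf{M}},F^{\mathbf{M}}\rangle$, $\langle M,F^{\mathbf{M}}\rangle$ an algebra of type $F$, $\preccurlyeq^{\mathbf{M}}:M\times M\to L$ with $a\preccurlyeq^{\mathbf{M}}a=1$, $(a\preccurlyeq^{\mathbf{M}}b)\otimes(b\preccurlyeq^{\mathbf{M}}c)\le a\preccurlyeq^{\mathbf{M}}c$, $(a_1\preccurlyeq^{\mathbf{M}}b_1)\otimes\cdots\otimes(a_n\preccurlyeq^{\mathbf{M}}b_n)\le f^{\mathbf{M}}(\vec a)\preccurlyeq^{\mathbf{M}}f^{\mathbf{M}}(\vec b)$, and $a\preccurlyeq^{\mathbf{M}}b=b\preccurlyeq^{\mathbf{M}}a=1\Rightarrow a=b$. Subalgebras (nonempty subuniverses with restricted structure), direct products (componentwise operations, $a\preccurlyeq b=\bigwedge_i a(i)\preccurlyeq^{\mathbf{M}_i}b(i)$; empty product is the one-element algebra), homomorphisms ($h$ preserving operations with $a\preccurlyeq^{\mathbf{M}}b\le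 h(a)\preccurlyeq^{\mathbf{N}}h(b)$), homomorphic images (images under surjective homomorphisms). A variety is a class of algebras with $\mathbf{L}$-order of type $F$ closed under subalgebras, homomorphic images and direct products. $\mathbf{T}(X)$ is the term algebra on the set $T(X)$ of terms over $X$ with $t\preccurlyeq t'=1$ if $t=t'$ and $0$ otherwise. An $\mathbf{L}$-preorder compatible with $\mathbf{M}$ is $\theta:M\times M\to L$ with $\preccurlyeq^{\mathbf{M}}\subseteq\theta$ (pointwise), $\theta(a,b)\otimes\theta(b,c)\le\theta(a,c)$, $\theta(a_1,b_1)\otimes\cdots\otimes\theta(a_n,b_n)\le\theta(f^{\mathbf{M}}(\vec a),f^{\mathbf{M}}(\vec b))$. The factor algebra $\mathbf{M}/\theta$ has universe the classes $[a]_\theta=\{b;\theta(a,b)=\theta(b,a)=1\}$, operations on representatives, and $[a]_\theta\preccurlyeq[b]_\theta=\theta(a,b)$. For a homomorphism $h:\mathbf{M}\to\mathbf{N}$, $\theta_h(a,b)=h(a)\preccurlyeq^{\mathbf{N}}h(b)$ (a compatible $\mathbf{L}$-preorder). $\Theta_X(\mathcal{K})=\{\theta_h;\,h:\mathbf{T}(X)\to\mathbf{M}\text{ a homomorphism},\ \mathbf{M}\in\mathcal{K}\}$, and $\theta_{\mathcal{K}}=\bigcap\Theta_X(\mathcal{K})$ (pointwise infimum), which is a compatible $\mathbf{L}$-preorder on $\mathbf{T}(X)$; $\mathbf{F}_X(\mathcal{K})=\mathbf{T}(X)/\theta_{\mathcal{K}}$. -}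

module Defs where

open import Agda.Primitive using (Level; _⊔_; Setω) renaming (lsuc to lsuc)
open import Level using (Lift; lift; lower)
open import Data.Nat using (ℕ; zero; suc)
open import Data.Fin using (Fin; zero; suc)
open import Data.Product using (Σ; _×_; _,_; proj₁; proj₂)
open import Relation.Binary.PropositionalEquality
  using (_≡_; refl; sym; trans; subst; subst₂; cong)
open import Relation.Binary.Structures using (IsPartialOrder; IsEquivalence)

record CompleteResiduatedLattice (ℓ : Level) : Setω where
  infixr 7 _⊗_
  infixr 6 _∧_
  infixr 5 _∨_
  infixr 4 _⇒_
  infix 3 _≤_
  field
    Carrier        : Set ℓ
    _≤_            : Carrier → Carrier → Set ℓ
    isPartialOrder : IsPartialOrder _≡_ _≤_
    _∧_ _∨_ _⊗_ _⇒_ : Carrier → Carrier → Carrier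
    𝟎 𝟏            : Carrier
    ∧-lowerˡ   : ∀ x y → x ∧ y ≤ x
    ∧-lowerʳ   : ∀ x y → x ∧ y ≤ y
    ∧-greatest : ∀ x y z → z ≤ x → z ≤ y → z ≤ x ∧ y
    ∨-upperˡ   : ∀ x y → x ≤ x ∨ y
    ∨-upperʳ   : ∀ x y → y ≤ x ∨ y
    ∨-least    : ∀ x y z → x ≤ z → y ≤ z → x ∨ y ≤ z
    𝟎-min      : ∀ x → 𝟎 ≤ x
    𝟏-max      : ∀ x → x ≤ 𝟏
    ⋀          : ∀ {i} {I : Set i} → (I → Carrier) → Carrier
    ⋀-lower    : ∀ {i} {I : Set i} (f : I → Carrier) (j : I) → ⋀ f ≤ f j
    ⋀-greatest : ∀ {i} {I : Set i} (f : I → Carrier) (x : Carrier) →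
                 (∀ j → x ≤ f j) → x ≤ ⋀ f
    ⋁          : ∀ {i} {I : Set i} → (I → Carrier) → Carrier
    ⋁-upper    : ∀ {i} {I : Set i} (f : I → Carrier) (j : I) → f j ≤ ⋁ f
    ⋁-least    : ∀ {i} {I : Set i} (f : I → Carrier) (x : Carrier) →
                 (∀ j → f j ≤ x) → ⋁ f ≤ x
    ⊗-assoc     : ∀ x y z → (x ⊗ y) ⊗ z ≡ x ⊗ (y ⊗ z)
    ⊗-comm      : ∀ x y → x ⊗ y ≡ y ⊗ x
    ⊗-identityˡ : ∀ x → 𝟏 ⊗ x ≡ x
    residuation : ∀ x y z → (x ⊗ y ≤ z → x ≤ y ⇒ z) × (x ≤ y ⇒ z → x ⊗ y ≤ z)

record Signature (ℓ : Level) : Set (lsuc ℓ) where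
  field
    Op    : Set ℓ
    arity : Op → ℕ

module Theory {ℓ : Level} (𝐋 : CompleteResiduatedLattice ℓ) (F : Signature ℓ) where

  open CompleteResiduatedLattice 𝐋 renaming (Carrier to L) public
  open Signature F public
  open IsPartialOrder isPartialOrder
    renaming (refl to ≤-refl; trans to ≤-trans; antisym to ≤-antisym; reflexive to ≤-reflexive)

  ⊗-identityʳ : ∀ x → x ⊗ 𝟏 ≡ x
  ⊗-identityʳ x = trans (⊗-comm x 𝟏) (⊗-identityˡ x)

  ⊗-monoˡ : ∀ {x x' y} → x ≤ x' → x ⊗ y ≤ x' ⊗ y
  ⊗-monoˡ {x} {x'} {y} p =
    proj₂ (residuation x y (x' ⊗ y))
      (≤-trans p (proj₁ (residuation x' y (x' ⊗ y)) ≤-refl))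

  ⊗-mono : ∀ {x x' y y'} → x ≤ x' → y ≤ y' → x ⊗ y ≤ x' ⊗ y'
  ⊗-mono {x} {x'} {y} {y'} p q =
    ≤-trans (⊗-monoˡ p)
      (subst₂ _≤_ (⊗-comm y x') (⊗-comm y' x') (⊗-monoˡ q))

  ≥𝟏 : ∀ {x} → 𝟏 ≤ x → x ≡ 𝟏
  ≥𝟏 {x} p = ≤-antisym (𝟏-max x) p

  ⋀-cong : ∀ {i} {I : Set i} {f g : I → L} → (∀ j → f j ≡ g j) → ⋀ f ≡ ⋀ g
  ⋀-cong {f = f} {g} e =
    ≤-antisym (⋀-greatest g (⋀ f) (λ j → ≤-trans (⋀-lower f j) (≤-reflexive (e j))))
              (⋀-greatest f (⋀ g) (λ j → ≤-trans (⋀-lower g j) (≤-reflexive (sym (e j)))))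

  ⋀-ones : ∀ {i} {I : Set i} {f : I → L} → (∀ j → f j ≡ 𝟏) → ⋀ f ≡ 𝟏
  ⋀-ones {f = f} e = ≥𝟏 (⋀-greatest f 𝟏 (λ j → ≤-reflexive (sym (e j))))

  ⨂ : ∀ {n} → (Fin n → L) → L
  ⨂ {zero}  _ = 𝟏
  ⨂ {suc n} v = v zero ⊗ ⨂ (λ i → v (suc i))

  ⨂-mono : ∀ {n} {u v : Fin n → L} → (∀ i → u i ≤ v i) → ⨂ u ≤ ⨂ v
  ⨂-mono {zero}  p = ≤-refl
  ⨂-mono {suc n} p = ⊗-mono (p zero) (⨂-mono (λ i → p (suc i)))

  ⨂-ones : ∀ {n} {u : Fin n → L} → (∀ i → u i ≡ 𝟏) → ⨂ u ≡ 𝟏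
  ⨂-ones {zero}  e = refl
  ⨂-ones {suc n} {u} e =
    trans (subst₂ (λ a b → u zero ⊗ ⨂ (λ i → u (suc i)) ≡ a ⊗ b) (e zero)
                  (⨂-ones (λ i → e (suc i))) refl)
          (⊗-identityˡ 𝟏)

  -- structures and algebras with L-order ---------------------------------
  -- Carriers are setoids (Agda has no quotient types); ≈ plays the role
  -- of equality of elements.

  record Structure (a : Level) : Set (lsuc a ⊔ ℓ) where
    infix 4 _≈_ _≼_
    field
      Carrier : Set a
      _≈_     : Carrier → Carrier → Set a
      ≈-equiv : IsEquivalence _≈_
      _≼_     : Carrier → Carrier → L
      op      : (f : Op) → (Fin (arity f) → Carrier) → Carrier

  record Alg (a : Level) : Set (lsuc a ⊔ ℓ) where
    field
      str : Structure a
    open Structure str public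
    field
      ≼-cong    : ∀ {x x' y y'} → x ≈ x' → y ≈ y' → (x ≼ y) ≡ (x' ≼ y')
      op-cong   : ∀ f {xs ys : Fin (arity f) → Carrier} →
                  (∀ i → xs i ≈ ys i) → op f xs ≈ op f ys
      ≼-refl    : ∀ x → (x ≼ x) ≡ 𝟏
      ≼-trans   : ∀ x y z → (x ≼ y) ⊗ (y ≼ z) ≤ (x ≼ z)
      ≼-compat  : ∀ f (xs ys : Fin (arity f) → Carrier) →
                  ⨂ (λ i → xs i ≼ ys i) ≤ (op f xs ≼ op f ys)
      ≼-antisym : ∀ x y → (x ≼ y) ≡ 𝟏 → (y ≼ x) ≡ 𝟏 → x ≈ y

  record Hom {a b} (M : Structure a) (N : Structure b) : Set (a ⊔ b ⊔ ℓ) where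
    private
      module M = Structure M
      module N = Structure N
    field
      fun     : M.Carrier → N.Carrier
      fun-cong : ∀ {x y} → x M.≈ y → fun x N.≈ fun y
      op-pres : ∀ f (xs : Fin (arity f) → M.Carrier) →
                fun (M.op f xs) N.≈ N.op f (λ i → fun (xs i))
      ≼-pres  : ∀ x y → (x M.≼ y) ≤ (fun x N.≼ fun y)

  Surjective : ∀ {a b} {M : Structure a} {N : Structure b} → Hom M N → Set (a ⊔ b)
  Surjective {N = N} h =
    ∀ y → Σ _ (λ x → Structure._≈_ N (Hom.fun h x) y)

  record Subuniverse {a} (M : Alg a) (p : Level) : Set (a ⊔ ℓ ⊔ lsuc p) where
    private module M = Alg M
    field
      member   : M.Carrier → Set p
      resp     : ∀ {x y} → x M.≈ y → member x → member y
      closed   : ∀ f (xs : Fin (arity f) → M.Carrier) →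
                 (∀ i → member (xs i)) → member (M.op f xs)
      nonempty : Σ M.Carrier member

  Sub : ∀ {a} {p} (M : Alg a) → Subuniverse M p → Alg (a ⊔ p)
  Sub {p = p} M U = record
    { str = record
      { Carrier = Σ M.Carrier U.member
      ; _≈_     = λ x y → Lift p (proj₁ x M.≈ proj₁ y)
      ; ≈-equiv = record { refl = lift E.refl ; sym = λ q → lift (E.sym (lower q))
                         ; trans = λ q r → lift (E.trans (lower q) (lower r)) }
      ; _≼_     = λ x y → proj₁ x M.≼ proj₁ y
      ; op      = λ f xs → M.op f (λ i → proj₁ (xs i)) , U.closed f _ (λ i → proj₂ (xs i))
      }
    ; ≼-cong    = λ q r → M.≼-cong (lower q) (lower r)
    ; op-cong   = λ f e → lift (M.op-cong f (λ i → lower (e i)))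
    ; ≼-refl    = λ x → M.≼-refl (proj₁ x)
    ; ≼-trans   = λ x y z → M.≼-trans (proj₁ x) (proj₁ y) (proj₁ z)
    ; ≼-compat  = λ f xs ys → M.≼-compat f (λ i → proj₁ (xs i)) (λ i → proj₁ (ys i))
    ; ≼-antisym = λ x y q r → lift (M.≼-antisym (proj₁ x) (proj₁ y) q r)
    }
    where
      module M = Alg M
      module U = Subuniverse U
      module E = IsEquivalence M.≈-equiv

  ∏ : ∀ {i a} {I : Set i} → (I → Alg a) → Alg (i ⊔ a)
  ∏ {I = I} M = record
    { str = record
      { Carrier = (j : I) → Alg.Carrier (M j)
      ; _≈_     = λ x y → ∀ j → Alg._≈_ (M j) (x j) (y j)
      ; ≈-equiv = record
        { refl  = λ j → IsEquivalence.refl (Alg.≈-equiv (M j))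
        ; sym   = λ p j → IsEquivalence.sym (Alg.≈-equiv (M j)) (p j)
        ; trans = λ p q j → IsEquivalence.trans (Alg.≈-equiv (M j)) (p j) (q j)
        }
      ; _≼_     = _≼∏_
      ; op      = λ f xs j → Alg.op (M j) f (λ i → xs i j)
      }
    ; ≼-cong    = λ p q → ⋀-cong (λ j → Alg.≼-cong (M j) (p j) (q j))
    ; op-cong   = λ f e j → Alg.op-cong (M j) f (λ i → e i j)
    ; ≼-refl    = λ x → ⋀-ones (λ j → Alg.≼-refl (M j) (x j))
    ; ≼-trans   = λ x y z →
        ⋀-greatest _ _ (λ j →
          ≤-trans (⊗-mono (⋀-lower _ j) (⋀-lower _ j)) (Alg.≼-trans (M j) (x j) (y j) (z j)))
    ; ≼-compat  = λ f xs ys →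
        ⋀-greatest _ _ (λ j →
          ≤-trans (⨂-mono {arity f} (λ i → ⋀-lower _ j))
                  (Alg.≼-compat (M j) f (λ i → xs i j) (λ i → ys i j)))
    ; ≼-antisym = λ x y p q j →
        Alg.≼-antisym (M j) (x j) (y j)
          (≥𝟏 (≤-trans (≤-reflexive (sym p)) (⋀-lower _ j)))
          (≥𝟏 (≤-trans (≤-reflexive (sym q)) (⋀-lower _ j)))
    }
    where
      _≼∏_ : ((j : I) → Alg.Carrier (M j)) → ((j : I) → Alg.Carrier (M j)) → L
      x ≼∏ y = ⋀ (λ j → Alg._≼_ (M j) (x j) (y j))

  record Variety : Setω where
    field
      κ        : Level → Level
      _∈K      : ∀ {a} → Alg a → Set (κ a)
      S-closed : ∀ {a p} {M : Alg a} (U : Subuniverse M p) → M ∈K → Sub M U ∈K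
      H-closed : ∀ {a b} {M : Alg a} {N : Alg b} (h : Hom (Alg.str M) (Alg.str N)) →
                 Surjective h → M ∈K → N ∈K
      P-closed : ∀ {i a} {I : Set i} (M : I → Alg a) → (∀ j → M j ∈K) → ∏ M ∈K

  data Term (X : Set ℓ) : Set ℓ where
    var  : X → Term X
    node : (f : Op) → (Fin (arity f) → Term X) → Term X

  data _≈T_ {X : Set ℓ} : Term X → Term X → Set ℓ where
    var  : ∀ {x y} → x ≡ y → var x ≈T var y
    node : ∀ f {ts us : Fin (arity f) → Term X} →
           (∀ i → ts i ≈T us i) → node f ts ≈T node f us

  ≈T-refl : ∀ {X} (t : Term X) → t ≈T t
  ≈T-refl (var x)     = var refl
  ≈T-refl (node f ts) = node f (λ i → ≈T-refl (ts i))

  ≈T-sym : ∀ {X} {t u : Term X} → t ≈T u → u ≈T t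
  ≈T-sym (var p)    = var (sym p)
  ≈T-sym (node f p) = node f (λ i → ≈T-sym (p i))

  ≈T-trans : ∀ {X} {t u v : Term X} → t ≈T u → u ≈T v → t ≈T v
  ≈T-trans (var p)    (var q)    = var (trans p q)
  ≈T-trans (node f p) (node .f q) = node f (λ i → ≈T-trans (p i) (q i))

  -- t ≼ t' = 1 if t = t' and 0 otherwise; written as the supremum of the
  -- constant family 1 indexed by proofs of t = t' (constructively meaningful).
  _≼T_ : ∀ {X} → Term X → Term X → L
  t ≼T u = ⋁ {I = t ≈T u} (λ _ → 𝟏)

  TermStr : (X : Set ℓ) → Structure ℓ
  TermStr X = record
    { Carrier = Term X
    ; _≈_     = _≈T_
    ; ≈-equiv = record { refl = ≈T-refl _ ; sym = ≈T-sym ; trans = ≈T-trans }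
    ; _≼_     = _≼T_
    ; op      = node
    }

  record CompatibleLPreorder (X : Set ℓ) : Set ℓ where
    field
      θ      : Term X → Term X → L
      ⊇≼     : ∀ s t → (s ≼T t) ≤ θ s t
      θ-trans  : ∀ r s t → θ r s ⊗ θ s t ≤ θ r t
      θ-compat : ∀ f (ss ts : Fin (arity f) → Term X) →
                 ⨂ (λ i → θ (ss i) (ts i)) ≤ θ (node f ss) (node f ts)

  -- T(X)/θ : elements are represented by terms, two terms being equal
  -- (i.e. in the same class [a]_θ) iff θ(a,b) = θ(b,a) = 1.
  Factor : ∀ {X} → CompatibleLPreorder X → Alg ℓ
  Factor {X} C = record
    { str = record
      { Carrier = Term X
      ; _≈_     = _~_
      ; ≈-equiv = record
        { refl  = λ {t} → θ-refl t , θ-refl t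
        ; sym   = λ p → proj₂ p , proj₁ p
        ; trans = λ p q → one-trans (proj₁ p) (proj₁ q) , one-trans (proj₂ q) (proj₂ p)
        }
      ; _≼_     = θ
      ; op      = node
      }
    ; ≼-cong    = λ {x} {x'} {y} {y'} p q →
        ≤-antisym (≤-trans (left (proj₂ p)) (right (proj₁ q)))
                  (≤-trans (left (proj₁ p)) (right (proj₂ q)))
    ; op-cong   = λ f {xs} {ys} e →
        ≥𝟏 (≤-trans (≤-reflexive (sym (⨂-ones (λ i → proj₁ (e i))))) (θ-compat f xs ys)) ,
        ≥𝟏 (≤-trans (≤-reflexive (sym (⨂-ones (λ i → proj₂ (e i))))) (θ-compat f ys xs))
    ; ≼-refl    = θ-refl
    ; ≼-trans   = θ-trans
    ; ≼-compat  = θ-compat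
    ; ≼-antisym = λ x y p q → p , q
    }
    where
      open CompatibleLPreorder C
      _~_ : Term X → Term X → Set ℓ
      a ~ b = (θ a b ≡ 𝟏) × (θ b a ≡ 𝟏)
      θ-refl : ∀ t → θ t t ≡ 𝟏
      θ-refl t = ≥𝟏 (≤-trans (⋁-upper (λ _ → 𝟏) (≈T-refl t)) (⊇≼ t t))
      left : ∀ {a b c} → θ a b ≡ 𝟏 → θ b c ≤ θ a c
      left {a} {b} {c} p =
        subst (_≤ θ a c) (⊗-identityˡ (θ b c))
              (subst (λ u → u ⊗ θ b c ≤ θ a c) p (θ-trans a b c))
      right : ∀ {a b c} → θ b c ≡ 𝟏 → θ a b ≤ θ a c
      right {a} {b} {c} p =
        subst (_≤ θ a c) (⊗-identityʳ (θ a b))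
              (subst (λ u → θ a b ⊗ u ≤ θ a c) p (θ-trans a b c))
      one-trans : ∀ {a b c} → θ a b ≡ 𝟏 → θ b c ≡ 𝟏 → θ a c ≡ 𝟏
      one-trans {a} {b} {c} p q = ≥𝟏 (≤-trans (≤-reflexive (sym q)) (left p))

  module _ (K : Variety) (X : Set ℓ) where
    open Variety K

    -- Θ_X(K) = { θ_h ; h : T(X) → M homomorphism, M ∈ K }, indexed by the pairs (M, h)
    ΘIndex : Set (lsuc ℓ ⊔ κ ℓ)
    ΘIndex = Σ (Alg ℓ) (λ M → (M ∈K) × Hom (TermStr X) (Alg.str M))

    θ_h : ΘIndex → Term X → Term X → L
    θ_h (M , _ , h) s t = Alg._≼_ M (Hom.fun h s) (Hom.fun h t)

    θK : Term X → Term X → L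
    θK s t = ⋀ (λ (j : ΘIndex) → θ_h j s t)

    θK-preorder : CompatibleLPreorder X
    θK-preorder = record
      { θ        = θK
      ; ⊇≼       = λ s t → ⋀-greatest _ _ (λ where
          (M , _ , h) → ⋁-least _ _ (λ p →
            ≤-reflexive (sym (trans (sym (Alg.≼-cong M (IsEquivalence.refl (Alg.≈-equiv M))
                                                         (Hom.fun-cong h p)))
                                    (Alg.≼-refl M (Hom.fun h s))))))
      ; θ-trans  = λ r s t → ⋀-greatest _ _ (λ where
          j@(M , _ , h) → ≤-trans (⊗-mono (⋀-lower _ j) (⋀-lower _ j))
                                  (Alg.≼-trans M (Hom.fun h r) (Hom.fun h s) (Hom.fun h t)))
      ; θ-compat = λ f ss ts → ⋀-greatest _ _ (λ where
          j@(M , _ , h) →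
            ≤-trans (⨂-mono {arity f} (λ i → ⋀-lower _ j))
              (≤-trans (Alg.≼-compat M f (λ i → Hom.fun h (ss i)) (λ i → Hom.fun h (ts i)))
                (≤-reflexive (Alg.≼-cong M
                  (IsEquivalence.sym (Alg.≈-equiv M) (Hom.op-pres h f ss))
                  (IsEquivalence.sym (Alg.≈-equiv M) (Hom.op-pres h f ts))))))
      }

    FreeAlg : Alg ℓ
    FreeAlg = Factor θK-preorder

-- θ_K is the kernel of the single homomorphism T(X) → ∏ Θ_X(K) obtained by tupling
-- all the homomorphisms that define Θ_X(K), and the product lies in K.  A factor of
-- T(X) by the kernel of a homomorphism into an algebra B is a homomorphic image of the
-- image of that homomorphism, a subalgebra of B (nonempty because T(X) is); so
-- F_X(K) is obtained from members of K by P, then S, then H.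
module Submission where

open import Defs
open import Agda.Primitive using (Level; _⊔_)
open import Level using (lower)
open import Data.Product using (Σ; _,_; proj₁; proj₂)
open import Relation.Binary.PropositionalEquality using (_≡_; refl; sym; trans)
open import Relation.Binary.Structures using (IsPartialOrder; IsEquivalence)

module _ {ℓ : Level} (𝐋 : CompleteResiduatedLattice ℓ) (F : Signature ℓ) where
  open Theory 𝐋 F
  open IsPartialOrder isPartialOrder using () renaming (reflexive to ≤-reflexive)

  module _ {a b} {M : Structure a} {B : Alg b} where
    private
      module M = Structure M
      module B = Alg B
      module ≈B = IsEquivalence B.≈-equiv

    image : Hom M (Alg.str B) → M.Carrier → Subuniverse B (a ⊔ b)
    image h m₀ = record
      { member   = λ y → Σ M.Carrier (λ x → fun x B.≈ y)
      ; resp     = λ y≈y' (x , fx≈y) → x , ≈B.trans fx≈y y≈y'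
      ; closed   = λ f ys ms →
          M.op f (λ i → proj₁ (ms i)) ,
          ≈B.trans (op-pres f _) (B.op-cong f (λ i → proj₂ (ms i)))
      ; nonempty = fun m₀ , m₀ , ≈B.refl
      }
      where open Hom h

  ∏-hom : ∀ {a b i} {I : Set i} {M : Structure a} (N : I → Alg b) →
          (∀ j → Hom M (Alg.str (N j))) → Hom M (Alg.str (∏ N))
  ∏-hom N h = record
    { fun      = λ x j → Hom.fun (h j) x
    ; fun-cong = λ x≈y j → Hom.fun-cong (h j) x≈y
    ; op-pres  = λ f xs j → Hom.op-pres (h j) f xs
    ; ≼-pres   = λ x y → ⋀-greatest _ _ (λ j → Hom.≼-pres (h j) x y)
    }

  _IsKernelOf_ : ∀ {X : Set ℓ} {b} {N : Structure b} →
                 CompatibleLPreorder X → Hom (TermStr X) N → Set ℓ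
  _IsKernelOf_ {N = N} C h =
    ∀ s t → CompatibleLPreorder.θ C s t ≡ Structure._≼_ N (Hom.fun h s) (Hom.fun h t)

  module _ {X : Set ℓ} {b} {B : Alg b} (C : CompatibleLPreorder X)
           (h : Hom (TermStr X) (Alg.str B)) (θ≡kernel : C IsKernelOf h) (t₀ : Term X) where
    private
      module B = Alg B
      module ≈B = IsEquivalence B.≈-equiv
      open Hom h using (fun)
      open CompatibleLPreorder C using (θ)

      θ≡𝟏 : ∀ {s t} → fun s B.≈ fun t → θ s t ≡ 𝟏
      θ≡𝟏 {s} {t} hs≈ht =
        trans (θ≡kernel s t) (trans (B.≼-cong hs≈ht ≈B.refl) (B.≼-refl (fun t)))

    image→factor : Hom (Alg.str (Sub B (image {B = B} h t₀))) (Alg.str (Factor C))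
    image→factor = record
      { fun      = λ y → proj₁ (proj₂ y)
      ; fun-cong = λ { {_ , s , hs≈y} {_ , t , ht≈y'} y≈y' →
            θ≡𝟏 (≈B.trans hs≈y (≈B.trans (lower y≈y') (≈B.sym ht≈y')))
          , θ≡𝟏 (≈B.trans ht≈y' (≈B.trans (≈B.sym (lower y≈y')) (≈B.sym hs≈y))) }
      ; op-pres  = λ f ys → IsEquivalence.refl (Alg.≈-equiv (Factor C))
      ; ≼-pres   = λ { (_ , s , hs≈y) (_ , t , ht≈y') →
            ≤-reflexive (trans (B.≼-cong (≈B.sym hs≈y) (≈B.sym ht≈y')) (sym (θ≡kernel s t))) }
      }

    image→factor-surjective : Surjective image→factor
    image→factor-surjective t =
      (fun t , t , ≈B.refl) , IsEquivalence.refl (Alg.≈-equiv (Factor C))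

  module _ (K : Variety) where
    open Variety K

    factor-by-kernel-∈K : ∀ {X : Set ℓ} {b} {B : Alg b} (C : CompatibleLPreorder X)
                          (h : Hom (TermStr X) (Alg.str B)) →
                          C IsKernelOf h → Term X → B ∈K → Factor C ∈K
    factor-by-kernel-∈K {B = B} C h θ≡kernel t₀ B∈K =
      H-closed (image→factor {B = B} C h θ≡kernel t₀)
               (image→factor-surjective {B = B} C h θ≡kernel t₀)
               (S-closed (image {B = B} h t₀) B∈K)

mainTheorem5 : ∀ {ℓ} (𝐋 : CompleteResiduatedLattice ℓ) (F : Signature ℓ)
                 (K : Theory.Variety 𝐋 F) (X : Set ℓ) →
                 Theory.Term 𝐋 F X →
                 Theory.Variety._∈K K (Theory.FreeAlg 𝐋 F K X)
mainTheorem5 𝐋 F K X t₀ =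
  factor-by-kernel-∈K 𝐋 F K (θK-preorder K X) (∏-hom 𝐋 F algebra homomorphism)
    (λ s t → refl) t₀ (P-closed algebra (λ j → proj₁ (proj₂ j)))
  where
    open Theory 𝐋 F
    open Variety K

    algebra : ΘIndex K X → Alg _
    algebra = proj₁

    homomorphism : (j : ΘIndex K X) → Hom (TermStr X) (Alg.str (algebra j))
    homomorphism j = proj₂ (proj₂ j)
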